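{- Let $G$ be the complete multipartite graph $K_{n_1,n_2,\dots,n_m}$, let $n=n_1+\dots+n_m$, and let \[ n'=\max\Big\{\sum_{i\in J}n_i \ \Big|\ J\subseteq\{1,2,\dots,m\},\ \sum_{i\in J}n_i\leq n/2\Big\}. \] Then for every integer $k$ with $2\leq k<n'$, \[ \gamma_{\times k,t}(G_I)\leq n(k+1)-2n'. \]
   Context: All graphs are finite, simple and undirected. For a graph $G$ without isolated vertices, the inflated graph $G_I$ is obtained as follows: each vertex $x_i$ of $G$ of degree $d(x_i)$ is replaced by a clique $X_i\cong K_{d(x_i)}$ whose vertices are labelled $x_ix_j$, one for each neighbour $x_j$ of $x_i$; and each edge $x_ix_j$ of $G$ is replaced by the edge joining $x_ix_j\in X_i$ to $x_jx_i\in X_j$. A set $S\subseteq V(H)$ is a $k$-tuple total dominating set of a graph $H$ if every vertex of $H$ has at least $k$ neighbours in $S$; $\gamma_{\times k,t}(H)$ denotes the minimum cardinality of such a set. -}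

module Defs where

open import Data.Nat using (ℕ; zero; suc; _+_; _*_; _≤_)
open import Data.Bool using (Bool; true; false; T; not; _∧_; _∨_; if_then_else_)
open import Data.Bool.Properties using (T-irrelevant)
open import Data.Fin using (Fin)
import Data.Fin as Fin
open import Data.Fin.Subset using (Subset)
open import Data.Vec using (Vec; []; _∷_; replicate)
open import Data.Product using (Σ; _×_; _,_; ∃-syntax)
open import Data.Product.Properties using (≡-dec)
open import Data.List using (List; length; filter)
open import Data.List.Relation.Unary.Unique.Propositional using (Unique)
open import Relation.Nullary using (yes; no; Dec)
open import Relation.Binary.PropositionalEquality using (_≡_)
open import Relation.Nullary.Decidable using (⌊_⌋)
open import Relation.Binary.Definitions using (DecidableEquality)
open import Relation.Unary using (Decidable)

record Graph : Set₁ where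
  field
    V     : Set
    _≟V_  : DecidableEquality V
    adj   : V → V → Bool

open Graph public

completeMultipartite : (m : ℕ) → (Fin m → ℕ) → Graph
completeMultipartite m ns = record
  { V    = Σ (Fin m) (λ i → Fin (ns i))
  ; _≟V_ = ≡-dec Fin._≟_ Fin._≟_
  ; adj  = λ { (i , _) (j , _) → not ⌊ i Fin.≟ j ⌋ }
  }

-- Inflated graph G_I: vertices x_i x_j are the pairs (x , y) with x adjacent
-- to y in G (the vertex x y lies in the clique X_x).  (x , y) ~ (x' , y') iff
--   x = x' and y ≠ y'   (clique X_x), or
--   x = y' and y = x'   (the edge replacing xy).
inflate : Graph → Graph
inflate G = record
  { V    = Σ (V G × V G) (λ { (x , y) → T (adj G x y) })
  ; _≟V_ = ≡-dec (≡-dec (_≟V_ G) (_≟V_ G)) (λ p q → yes (T-irrelevant p q))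
  ; adj  = λ { ((x , y) , _) ((x' , y') , _) →
               (⌊ _≟V_ G x x' ⌋ ∧ not ⌊ _≟V_ G y y' ⌋)
             ∨ (⌊ _≟V_ G x y' ⌋ ∧ ⌊ _≟V_ G y x' ⌋) }
  }

IsKTupleTDS : (H : Graph) → ℕ → List (V H) → Set
IsKTupleTDS H k S =
  Unique S × (∀ v → k ≤ length (filter (λ u → T? (adj H v u)) S))
  where
    T? : ∀ b → Dec (T b)
    T? true  = yes _
    T? false = no (λ ())

sumOver : {m : ℕ} → (Fin m → ℕ) → Subset m → ℕ
sumOver {zero}  ns []      = 0
sumOver {suc m} ns (b ∷ J) = (if b then ns Fin.zero else 0) + sumOver (λ i → ns (Fin.suc i)) J

total : {m : ℕ} → (Fin m → ℕ) → ℕ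
total {m} ns = sumOver ns (replicate m true)

-- n' is the maximum of Σ_{i∈J} n_i over J ⊆ {1..m} with Σ_{i∈J} n_i ≤ n/2
-- (the condition s ≤ n/2 is written 2 * s ≤ n).
IsMaxHalfSum : {m : ℕ} → (Fin m → ℕ) → ℕ → Set
IsMaxHalfSum {m} ns n' =
    (∃[ J ] (2 * sumOver ns J ≤ total ns × sumOver ns J ≡ n'))
  × (∀ (J : Subset m) → 2 * sumOver ns J ≤ total ns → sumOver ns J ≤ n')

module Submission where

-- A vertex xy of the inflated graph G_I sees the other vertices xz of
-- its clique X_x and the vertex yx.  If every vertex x of G "chooses" a set of
-- neighbours, the vertices xy with y chosen by x form a k-tuple total
-- dominating set as soon as each x chooses k+1 neighbours, or k neighbours
-- each of which chooses x back (then yx makes up for the missing xy).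

open import Defs
open import Data.Nat using (ℕ; zero; suc; _+_; _*_; _∸_; _≤_; _<_; z≤n; s≤s; s≤s⁻¹; NonZero; >-nonZero)
open import Data.Nat.Properties
  using (≤-trans; ≤-reflexive; <-trans; <-irrefl; <⇒≤; +-assoc; +-comm; +-identityʳ; +-cancelˡ-≤;
         module ≤-Reasoning;
         m+[n∸m]≡n; m∸n+n≡m; m+n∸n≡m; m≤n⇒m⊓n≡m)
open import Data.Nat.DivMod using (_%_; %-distribˡ-+; m%n%n≡m%n; [m+n]%n≡m%n; m<n⇒m%n≡m; m%n<n)
open import Data.Nat.ListAction using (sum)
open import Data.Nat.ListAction.Properties using (sum-++)
open import Data.Nat.Tactic.RingSolver using (solve-∀)
open import Data.Bool using (Bool; true; false; T; not; if_then_else_)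
open import Data.Bool.Properties using (T-irrelevant)
open import Data.Fin using (Fin; zero; suc)
import Data.Fin as Fin
open import Data.Fin.Subset using (Subset; ∁)
open import Data.Vec using ([]; _∷_; lookup)
open import Data.Vec.Properties using (lookup-map)
open import Data.List
  using (List; []; _∷_; length; filter; map; concatMap; cartesianProduct; applyUpTo; allFin; _++_; take; drop)
open import Data.List.Properties
  using (length-map; length-++; filter-all; length-applyUpTo; length-tabulate; length-take; length-drop;
         take++drop≡id; map-++)
open import Data.List.Relation.Unary.Any using (Any; here; there)
open import Data.List.Relation.Unary.All using (All; []; _∷_; tabulate)
import Data.List.Relation.Unary.All as All
open import Data.List.Relation.Unary.All.Properties using (¬Any⇒All¬)
open import Data.List.Relation.Unary.Unique.Propositional using (Unique; []; _∷_)
open import Data.List.Relation.Unary.Unique.Propositional.Properties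
  using (cartesianProduct⁺; filter⁺; map⁺; ++⁺; allFin⁺; take⁺; applyUpTo⁺₁; Unique[x∷xs]⇒x∉xs)
open import Data.List.Membership.Propositional using (_∈_; _∉_)
open import Data.List.Membership.Propositional.Properties
  using (∈-filter⁺; ∈-filter⁻; ∈-map⁺; ∈-map⁻; ∈-cartesianProduct⁺; ∈-concatMap⁺; ∈-applyUpTo⁺; ∈-applyUpTo⁻;
         ∈-++⁺ˡ; ∈-++⁺ʳ; ∈-++⁻; ∈-allFin)
open import Data.Product using (Σ; _×_; _,_; proj₁; proj₂; ∃-syntax; map₁)
open import Data.Sum using (_⊎_; inj₁; inj₂)
open import Data.Empty using (⊥; ⊥-elim)
open import Relation.Nullary using (Dec; yes; no; ¬_; ¬?)
open import Relation.Nullary.Decidable using (⌊_⌋; isYes≗does; dec-true; dec-false)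
open import Relation.Binary.PropositionalEquality
  using (_≡_; _≢_; refl; sym; trans; cong; cong₂; subst; module ≡-Reasoning)
open import Relation.Binary.Definitions using (DecidableEquality)

⌊⌋-yes : ∀ {a} {A : Set a} (d : Dec A) → A → ⌊ d ⌋ ≡ true
⌊⌋-yes d a = trans (isYes≗does d) (dec-true d a)

⌊⌋-no : ∀ {a} {A : Set a} (d : Dec A) → ¬ A → ⌊ d ⌋ ≡ false
⌊⌋-no d ¬a = trans (isYes≗does d) (dec-false d ¬a)

module _ {A : Set} where

  remove : ∀ {x : A} (ys : List A) → x ∈ ys → List A
  remove (y ∷ ys) (here _)  = ys
  remove (y ∷ ys) (there p) = y ∷ remove ys p

  length-remove : ∀ {x : A} (ys : List A) (p : x ∈ ys) →
                  length ys ≡ suc (length (remove ys p))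
  length-remove (y ∷ ys) (here _)  = refl
  length-remove (y ∷ ys) (there p) = cong suc (length-remove ys p)

  ∈-remove : ∀ {x a : A} (ys : List A) (p : x ∈ ys) → a ∈ ys → a ≢ x → a ∈ remove ys p
  ∈-remove (y ∷ ys) (here refl) (here refl) a≢x = ⊥-elim (a≢x refl)
  ∈-remove (y ∷ ys) (here refl) (there q)   _   = q
  ∈-remove (y ∷ ys) (there p)   (here refl) _   = here refl
  ∈-remove (y ∷ ys) (there p)   (there q)   a≢x = there (∈-remove ys p q a≢x)

  unique-⊆⇒length-≤ : ∀ {xs ys : List A} → Unique xs → (∀ {a} → a ∈ xs → a ∈ ys) →
                      length xs ≤ length ys
  unique-⊆⇒length-≤ {[]}     _              _   = z≤n
  unique-⊆⇒length-≤ {x ∷ xs} {ys} u@(_ ∷ uxs) xs⊆ys =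
    subst (suc (length xs) ≤_) (sym (length-remove ys x∈ys)) (s≤s (unique-⊆⇒length-≤ uxs xs⊆rest))
    where
      x∈ys : x ∈ ys
      x∈ys = xs⊆ys (here refl)
      xs⊆rest : ∀ {a} → a ∈ xs → a ∈ remove ys x∈ys
      xs⊆rest a∈xs = ∈-remove ys x∈ys (xs⊆ys (there a∈xs))
                       (λ { refl → Unique[x∷xs]⇒x∉xs u a∈xs })

module _ {A : Set} (_≟_ : DecidableEquality A) where

  without : A → List A → List A
  without y = filter (λ z → ¬? (z ≟ y))

  length-without-∉ : ∀ {y} (xs : List A) → y ∉ xs → length (without y xs) ≡ length xs
  length-without-∉ {y} xs y∉xs =
    cong length (filter-all (λ z → ¬? (z ≟ y)) (All.map (λ y≢z z≡y → y≢z (sym z≡y)) (¬Any⇒All¬ xs y∉xs)))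

  length-without : ∀ y (xs : List A) → Unique xs → length xs ≤ suc (length (without y xs))
  length-without y []       _          = z≤n
  length-without y (x ∷ xs) u@(_ ∷ uxs) with x ≟ y
  ... | yes refl = ≤-reflexive (cong suc (sym (length-without-∉ xs (Unique[x∷xs]⇒x∉xs u))))
  ... | no _     = s≤s (length-without y xs uxs)

Loopless : Graph → Set
Loopless G = ∀ {x y} → T (adj G x y) → x ≢ y

record Selection (G : Graph) (k : ℕ) : Set where
  field
    vertices          : List (V G)
    vertices-unique   : Unique vertices
    vertices-complete : ∀ x → x ∈ vertices
    chosen            : V G → List (V G)
    chosen-unique     : ∀ x → Unique (chosen x)
    chosen-adjacent   : ∀ {x y} → y ∈ chosen x → T (adj G x y)
    chosen-enough     : ∀ x → suc k ≤ length (chosen x)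
                            ⊎ (k ≤ length (chosen x) × (∀ {y} → y ∈ chosen x → x ∈ chosen y))

  size : ℕ
  size = sum (map (λ x → length (chosen x)) vertices)

-- If x chose at least
-- k+1 neighbours, the xz with z chosen suffice; otherwise y ∉ chosen x leaves
-- all k of them, while y ∈ chosen x loses one but gains yx ∈ S by symmetry.
module SelectionDominates (G : Graph) (k : ℕ) (loopless : Loopless G) (σ : Selection G k) where

  open Selection σ

  Node : Set
  Node = V (inflate G)

  _≟_ : DecidableEquality (V G)
  _≟_ = _≟V_ G

  open import Data.List.Membership.DecPropositional _≟_ using (_∈?_)

  node-≡ : {u v : Node} → proj₁ u ≡ proj₁ v → u ≡ v
  node-≡ {_ , t} {_ , t'} refl = cong (_ ,_) (T-irrelevant t t')

  keepChosen : List (V G × V G) → List Node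
  keepChosen []            = []
  keepChosen ((x , y) ∷ r) with y ∈? chosen x
  ... | yes y∈ = ((x , y) , chosen-adjacent y∈) ∷ keepChosen r
  ... | no _   = keepChosen r

  keepChosen-sound : ∀ {u} ps → u ∈ keepChosen ps →
                     proj₁ u ∈ ps × proj₂ (proj₁ u) ∈ chosen (proj₁ (proj₁ u))
  keepChosen-sound ((x , y) ∷ r) u∈ with y ∈? chosen x
  keepChosen-sound ((x , y) ∷ r) (here refl) | yes y∈ = here refl , y∈
  keepChosen-sound ((x , y) ∷ r) (there u∈)  | yes _  = map₁ there (keepChosen-sound r u∈)
  keepChosen-sound ((x , y) ∷ r) u∈          | no _   = map₁ there (keepChosen-sound r u∈)

  keepChosen-complete : ∀ {x y} ps → (x , y) ∈ ps → y ∈ chosen x → (t : T (adj G x y)) →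
                        ((x , y) , t) ∈ keepChosen ps
  keepChosen-complete ((x , y) ∷ r) p           y∈ t with y ∈? chosen x
  keepChosen-complete ((x , y) ∷ r) (here refl) y∈ t | yes _  = here (node-≡ refl)
  keepChosen-complete ((x , y) ∷ r) (there p)   y∈ t | yes _  = there (keepChosen-complete r p y∈ t)
  keepChosen-complete ((x , y) ∷ r) (here refl) y∈ t | no y∉ = ⊥-elim (y∉ y∈)
  keepChosen-complete ((x , y) ∷ r) (there p)   y∈ t | no _  = keepChosen-complete r p y∈ t

  keepChosen-unique : ∀ ps → Unique ps → Unique (keepChosen ps)
  keepChosen-unique []            _ = []
  keepChosen-unique ((x , y) ∷ r) u@(_ ∷ ur) with y ∈? chosen x
  ... | yes _ = ¬Any⇒All¬ _ (λ p∈ → Unique[x∷xs]⇒x∉xs u (proj₁ (keepChosen-sound r p∈)))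
                ∷ keepChosen-unique r ur
  ... | no _  = keepChosen-unique r ur

  length-keepChosen : ∀ ps → All (λ p → proj₂ p ∈ chosen (proj₁ p)) ps →
                      length (keepChosen ps) ≡ length ps
  length-keepChosen []            _        = refl
  length-keepChosen ((x , y) ∷ r) (y∈ ∷ a) with y ∈? chosen x
  ... | yes _  = cong suc (length-keepChosen r a)
  ... | no y∉ = ⊥-elim (y∉ y∈)

  S : List Node
  S = keepChosen (cartesianProduct vertices vertices)

  S-unique : Unique S
  S-unique = keepChosen-unique _ (cartesianProduct⁺ vertices-unique vertices-unique)

  ∈S : ∀ {x y} → y ∈ chosen x → (t : T (adj G x y)) → ((x , y) , t) ∈ S
  ∈S {x} {y} y∈ t = keepChosen-complete _
    (∈-cartesianProduct⁺ (vertices-complete x) (vertices-complete y)) y∈ t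

  chosenPairs : List (V G × V G)
  chosenPairs = concatMap (λ x → map (x ,_) (chosen x)) vertices

  length-chosenPairs : ∀ xs → length (concatMap (λ x → map (x ,_) (chosen x)) xs)
                              ≡ sum (map (λ x → length (chosen x)) xs)
  length-chosenPairs []       = refl
  length-chosenPairs (x ∷ xs) =
    trans (length-++ (map (x ,_) (chosen x)))
          (cong₂ _+_ (length-map (x ,_) (chosen x)) (length-chosenPairs xs))

  S-length : length S ≤ size
  S-length = ≤-trans (≤-reflexive (sym (length-map proj₁ S)))
               (≤-trans (unique-⊆⇒length-≤ (map⁺ node-≡ S-unique) S⊆chosenPairs)
                        (≤-reflexive (length-chosenPairs vertices)))
    where
      S⊆chosenPairs : ∀ {p} → p ∈ map proj₁ S → p ∈ chosenPairs
      S⊆chosenPairs p∈ with ∈-map⁻ proj₁ p∈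
      ... | ((x , y) , _) , u∈S , refl =
        ∈-concatMap⁺ (λ z → map (z ,_) (chosen z)) (Any-at (vertices-complete x)
          (∈-map⁺ (x ,_) (proj₂ (keepChosen-sound (cartesianProduct vertices vertices) u∈S))))
        where
          Any-at : ∀ {zs} → x ∈ zs → (x , y) ∈ map (x ,_) (chosen x) →
                   Any (λ z → (x , y) ∈ map (z ,_) (chosen z)) zs
          Any-at (here refl) q = here q
          Any-at (there p)   q = there (Any-at p q)

  neighbours-≥ : ∀ v (P? : ∀ u → Dec (T (adj (inflate G) v u))) (W : List Node) → Unique W →
                 (∀ {u} → u ∈ W → u ∈ S × T (adj (inflate G) v u)) → length W ≤ length (filter P? S)
  neighbours-≥ v P? W uW W⊆ = unique-⊆⇒length-≤ uW (λ u∈W → let (u∈S , vu) = W⊆ u∈W in ∈-filter⁺ P? u∈S vu)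

  siblings : V G → V G → List Node
  siblings x y = keepChosen (map (x ,_) (without _≟_ y (chosen x)))

  siblings-member : ∀ {x y u} → u ∈ siblings x y →
                    Σ (V G) (λ z → proj₁ u ≡ (x , z) × z ∈ chosen x × z ≢ y)
  siblings-member {x} {y} u∈ with ∈-map⁻ (x ,_) (proj₁ (keepChosen-sound (map (x ,_) (without _≟_ y (chosen x))) u∈))
  ... | z , z∈ , eq = let (z∈x , z≢y) = ∈-filter⁻ (λ w → ¬? (w ≟ y)) z∈ in z , eq , z∈x , z≢y

  length-siblings : ∀ x y → length (siblings x y) ≡ length (without _≟_ y (chosen x))
  length-siblings x y =
    trans (length-keepChosen _ (tabulate all-chosen)) (length-map (x ,_) (without _≟_ y (chosen x)))
    where
      all-chosen : ∀ {p} → p ∈ map (x ,_) (without _≟_ y (chosen x)) → proj₂ p ∈ chosen (proj₁ p)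
      all-chosen p∈ with ∈-map⁻ (x ,_) p∈
      ... | z , z∈ , refl = proj₁ (∈-filter⁻ (λ w → ¬? (w ≟ y)) z∈)

  siblings-unique : ∀ x y → Unique (siblings x y)
  siblings-unique x y = keepChosen-unique _ (map⁺ (cong proj₂) (filter⁺ (λ w → ¬? (w ≟ y)) (chosen-unique x)))

  siblings-dominate : ∀ x y t {u} → u ∈ siblings x y → u ∈ S × T (adj (inflate G) ((x , y) , t) u)
  siblings-dominate x y t {(_ , t')} u∈ with siblings-member u∈
  ... | z , refl , z∈x , z≢y = ∈S z∈x t' , same-clique
    where
      same-clique : T (adj (inflate G) ((x , y) , t) ((x , z) , t'))
      same-clique rewrite ⌊⌋-yes (x ≟ x) refl | ⌊⌋-no (y ≟ z) (λ e → z≢y (sym e)) = _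

  siblings-count : ∀ x y t (P? : ∀ u → Dec (T (adj (inflate G) ((x , y) , t) u))) →
                   length (without _≟_ y (chosen x)) ≤ length (filter P? S)
  siblings-count x y t P? = subst (_≤ length (filter P? S)) (length-siblings x y)
    (neighbours-≥ ((x , y) , t) P? (siblings x y) (siblings-unique x y) (siblings-dominate x y t))

  -- The decisive case: y is chosen by x and x by y, so yx ∈ S replaces the
  -- missing sibling xy.
  partner-count : ∀ x y t (P? : ∀ u → Dec (T (adj (inflate G) ((x , y) , t) u))) → x ∈ chosen y →
                  length (chosen x) ≤ length (filter P? S)
  partner-count x y t P? x∈y =
    ≤-trans (length-without _≟_ y (chosen x) (chosen-unique x))
      (≤-trans (≤-reflexive (cong suc (sym (length-siblings x y))))
               (neighbours-≥ ((x , y) , t) P? (partner ∷ siblings x y) W-unique W⊆))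
    where
      partner : Node
      partner = (y , x) , chosen-adjacent x∈y

      W-unique : Unique (partner ∷ siblings x y)
      W-unique = ¬Any⇒All¬ _ (λ p∈ → let (_ , eq , _) = siblings-member p∈ in loopless t (sym (cong proj₁ eq)))
                 ∷ siblings-unique x y

      partner-adjacent : T (adj (inflate G) ((x , y) , t) partner)
      partner-adjacent rewrite ⌊⌋-no (x ≟ y) (loopless t) | ⌊⌋-yes (x ≟ x) refl | ⌊⌋-yes (y ≟ y) refl = _

      W⊆ : ∀ {u} → u ∈ partner ∷ siblings x y → u ∈ S × T (adj (inflate G) ((x , y) , t) u)
      W⊆ (here refl) = ∈S x∈y _ , partner-adjacent
      W⊆ (there u∈)  = siblings-dominate x y t u∈

  dominated : ∀ v (P? : ∀ u → Dec (T (adj (inflate G) v u))) → k ≤ length (filter P? S)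
  dominated ((x , y) , t) P? with chosen-enough x
  ... | inj₁ k<|x| =
    ≤-trans (s≤s⁻¹ (≤-trans k<|x| (length-without _≟_ y (chosen x) (chosen-unique x))))
            (siblings-count x y t P?)
  ... | inj₂ (k≤|x| , chosen-back) with y ∈? chosen x
  ...   | no y∉  = ≤-trans k≤|x|
    (subst (_≤ length (filter P? S)) (length-without-∉ _≟_ (chosen x) y∉) (siblings-count x y t P?))
  ...   | yes y∈ = ≤-trans k≤|x| (partner-count x y t P? (chosen-back y∈))

selection-dominates : ∀ {G k} → Loopless G → (σ : Selection G k) →
                      ∃[ S ] (IsKTupleTDS (inflate G) k S × length S ≤ Selection.size σ)
selection-dominates {G} {k} loopless σ = S , (S-unique , λ v → dominated v _) , S-length
  where open SelectionDominates G k loopless σ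

module Positions {A : Set} (_≟_ : DecidableEquality A) where

  position : A → List A → ℕ
  position x []       = 0
  position x (y ∷ ys) with x ≟ y
  ... | yes _ = 0
  ... | no _  = suc (position x ys)

  at : A → List A → ℕ → A
  at d []       i       = d
  at d (y ∷ ys) zero    = y
  at d (y ∷ ys) (suc i) = at d ys i

  position-< : ∀ {x xs} → x ∈ xs → position x xs < length xs
  position-< {x} {y ∷ ys} x∈ with x ≟ y
  position-< {x} {y ∷ ys} x∈          | yes _ = s≤s z≤n
  position-< {x} {y ∷ ys} (here x≡y)  | no x≢y = ⊥-elim (x≢y x≡y)
  position-< {x} {y ∷ ys} (there x∈) | no _   = s≤s (position-< x∈)

  at-position : ∀ d {x xs} → x ∈ xs → at d xs (position x xs) ≡ x
  at-position d {x} {y ∷ ys} x∈ with x ≟ y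
  at-position d {x} {y ∷ ys} x∈          | yes x≡y = sym x≡y
  at-position d {x} {y ∷ ys} (here x≡y)  | no x≢y  = ⊥-elim (x≢y x≡y)
  at-position d {x} {y ∷ ys} (there x∈) | no _    = at-position d x∈

  at-∈ : ∀ d xs {i} → i < length xs → at d xs i ∈ xs
  at-∈ d (y ∷ ys) {zero}  _       = here refl
  at-∈ d (y ∷ ys) {suc i} (s≤s i<) = there (at-∈ d ys i<)

  position-at : ∀ d xs → Unique xs → ∀ {i} → i < length xs → position (at d xs i) xs ≡ i
  position-at d (y ∷ ys) _ {zero} _ with y ≟ y
  ... | yes _  = refl
  ... | no y≢y = ⊥-elim (y≢y refl)
  position-at d (y ∷ ys) u@(_ ∷ uys) {suc i} (s≤s i<) with at d ys i ≟ y
  ... | yes refl = ⊥-elim (Unique[x∷xs]⇒x∉xs u (at-∈ d ys i<))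
  ... | no _     = cong suc (position-at d ys uys i<)

  at-injective : ∀ d xs → Unique xs → ∀ {i j} → i < length xs → j < length xs →
                 at d xs i ≡ at d xs j → i ≡ j
  at-injective d xs u {i} {j} i< j< eq =
    trans (sym (position-at d xs u i<)) (trans (cong (λ z → position z xs) eq) (position-at d xs u j<))

module Cyclic (N : ℕ) .{{_ : NonZero N}} where

  infixl 6 _⊕_ _⊖_

  _⊕_ : ℕ → ℕ → ℕ
  i ⊕ j = (i + j) % N

  _⊖_ : ℕ → ℕ → ℕ
  i ⊖ j = (i + (N ∸ j)) % N

  ⊕-< : ∀ i j → i ⊕ j < N
  ⊕-< i j = m%n<n (i + j) N

  ⊖-< : ∀ i j → i ⊖ j < N
  ⊖-< i j = m%n<n (i + (N ∸ j)) N

  ⊕-comm : ∀ i j → i ⊕ j ≡ j ⊕ i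
  ⊕-comm i j = cong (_% N) (+-comm i j)

  %-absorbˡ : ∀ a b → (a % N + b) % N ≡ (a + b) % N
  %-absorbˡ a b = begin
    (a % N + b) % N           ≡⟨ %-distribˡ-+ (a % N) b N ⟩
    (a % N % N + b % N) % N   ≡⟨ cong (λ t → (t + b % N) % N) (m%n%n≡m%n a N) ⟩
    (a % N + b % N) % N       ≡⟨ %-distribˡ-+ a b N ⟨
    (a + b) % N               ∎
    where open ≡-Reasoning

  +N-% : ∀ {i} → i < N → (i + N) % N ≡ i
  +N-% {i} i<N = trans ([m+n]%n≡m%n i N) (m<n⇒m%n≡m i<N)

  ⊕-⊖ : ∀ {i j} → i < N → j ≤ N → i ⊕ j ⊖ j ≡ i
  ⊕-⊖ {i} {j} i<N j≤N = begin
    ((i + j) % N + (N ∸ j)) % N   ≡⟨ %-absorbˡ (i + j) (N ∸ j) ⟩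
    (i + j + (N ∸ j)) % N         ≡⟨ cong (_% N) (+-assoc i j (N ∸ j)) ⟩
    (i + (j + (N ∸ j))) % N       ≡⟨ cong (λ t → (i + t) % N) (m+[n∸m]≡n j≤N) ⟩
    (i + N) % N                   ≡⟨ +N-% i<N ⟩
    i                             ∎
    where open ≡-Reasoning

  ⊖-⊕ : ∀ {i j} → i < N → j ≤ N → i ⊖ j ⊕ j ≡ i
  ⊖-⊕ {i} {j} i<N j≤N = begin
    ((i + (N ∸ j)) % N + j) % N   ≡⟨ %-absorbˡ (i + (N ∸ j)) j ⟩
    (i + (N ∸ j) + j) % N         ≡⟨ cong (_% N) (+-assoc i (N ∸ j) j) ⟩
    (i + ((N ∸ j) + j)) % N       ≡⟨ cong (λ t → (i + t) % N) (m∸n+n≡m j≤N) ⟩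
    (i + N) % N                   ≡⟨ +N-% i<N ⟩
    i                             ∎
    where open ≡-Reasoning

  ⊕-⊖ˡ : ∀ {i j} → i ≤ N → j < N → i ⊕ j ⊖ i ≡ j
  ⊕-⊖ˡ {i} {j} i≤N j<N = trans (cong (_⊖ i) (⊕-comm i j)) (⊕-⊖ j<N i≤N)

  ⊖-involutive : ∀ {i j} → i < N → j < N → i ⊖ (i ⊖ j) ≡ j
  ⊖-involutive {i} {j} i<N j<N = begin
    i ⊖ (i ⊖ j)               ≡⟨ cong (_⊖ (i ⊖ j)) (sym (⊖-⊕ i<N (<⇒≤ j<N))) ⟩
    (i ⊖ j) ⊕ j ⊖ (i ⊖ j)     ≡⟨ ⊕-⊖ˡ (<⇒≤ (⊖-< i j)) j<N ⟩
    j                         ∎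
    where open ≡-Reasoning

module Circulant {A : Set} (_≟_ : DecidableEquality A) {k N : ℕ} (k<N : k < N)
  {P Q : List A} (P-unique : Unique P) (Q-unique : Unique Q)
  (|P|≡N : length P ≡ N) (|Q|≡N : length Q ≡ N) where

  open Positions _≟_

  instance
    N-nonZero : NonZero N
    N-nonZero = >-nonZero (≤-trans (s≤s z≤n) k<N)

  open Cyclic N

  partnersP : A → List A
  partnersP x = applyUpTo (λ j → at x Q (position x P ⊕ j)) k

  partnersQ : A → List A
  partnersQ y = applyUpTo (λ j → at y P (position y Q ⊖ j)) k

  private
    <k⇒<N : ∀ {j} → j < k → j < N
    <k⇒<N j<k = <-trans j<k k<N

    <N⇒<|P| : ∀ {i} → i < N → i < length P
    <N⇒<|P| = subst (_ <_) (sym |P|≡N)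

    <N⇒<|Q| : ∀ {i} → i < N → i < length Q
    <N⇒<|Q| = subst (_ <_) (sym |Q|≡N)

    position-<N : ∀ {x xs} → length xs ≡ N → x ∈ xs → position x xs < N
    position-<N |xs| x∈ = subst (_ <_) |xs| (position-< x∈)

  length-partnersP : ∀ x → length (partnersP x) ≡ k
  length-partnersP x = length-applyUpTo _ k

  length-partnersQ : ∀ y → length (partnersQ y) ≡ k
  length-partnersQ y = length-applyUpTo _ k

  partnersP-⊆ : ∀ {x y} → y ∈ partnersP x → y ∈ Q
  partnersP-⊆ {x} y∈ with ∈-applyUpTo⁻ _ y∈
  ... | j , _ , refl = at-∈ x Q (<N⇒<|Q| (⊕-< _ j))

  partnersQ-⊆ : ∀ {y x} → x ∈ partnersQ y → x ∈ P
  partnersQ-⊆ {y} x∈ with ∈-applyUpTo⁻ _ x∈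
  ... | j , _ , refl = at-∈ y P (<N⇒<|P| (⊖-< _ j))

  partnersP-unique : ∀ {x} → x ∈ P → Unique (partnersP x)
  partnersP-unique {x} x∈P = applyUpTo⁺₁ _ k λ {i} {j} i<j j<k eq →
    let i<N = <k⇒<N (<-trans i<j j<k) ; j<N = <k⇒<N j<k
        p≤N = <⇒≤ (position-<N |P|≡N x∈P)
        same = at-injective x Q Q-unique (<N⇒<|Q| (⊕-< _ i)) (<N⇒<|Q| (⊕-< _ j)) eq
    in <-irrefl (trans (sym (⊕-⊖ˡ p≤N i<N)) (trans (cong (_⊖ position x P) same) (⊕-⊖ˡ p≤N j<N))) i<j

  partnersQ-unique : ∀ {y} → y ∈ Q → Unique (partnersQ y)
  partnersQ-unique {y} y∈Q = applyUpTo⁺₁ _ k λ {i} {j} i<j j<k eq →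
    let i<N = <k⇒<N (<-trans i<j j<k) ; j<N = <k⇒<N j<k
        p<N = position-<N |Q|≡N y∈Q
        same = at-injective y P P-unique (<N⇒<|P| (⊖-< _ i)) (<N⇒<|P| (⊖-< _ j)) eq
    in <-irrefl (trans (sym (⊖-involutive p<N i<N)) (trans (cong (position y Q ⊖_) same) (⊖-involutive p<N j<N))) i<j

  partnersP-symmetric : ∀ {x y} → x ∈ P → y ∈ partnersP x → x ∈ partnersQ y
  partnersP-symmetric {x} x∈P y∈ with ∈-applyUpTo⁻ _ y∈
  ... | j , j<k , refl = subst (_∈ partnersQ y) back (∈-applyUpTo⁺ _ j<k)
    where
      y : A
      y = at x Q (position x P ⊕ j)

      back : at y P (position y Q ⊖ j) ≡ x
      back = begin
        at y P (position y Q ⊖ j)       ≡⟨ cong (λ t → at y P (t ⊖ j)) (position-at x Q Q-unique (<N⇒<|Q| (⊕-< _ j))) ⟩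
        at y P (position x P ⊕ j ⊖ j)   ≡⟨ cong (at y P) (⊕-⊖ (position-<N |P|≡N x∈P) (<⇒≤ (<k⇒<N j<k))) ⟩
        at y P (position x P)           ≡⟨ at-position y x∈P ⟩
        x                               ∎
        where open ≡-Reasoning

  partnersQ-symmetric : ∀ {y x} → y ∈ Q → x ∈ partnersQ y → y ∈ partnersP x
  partnersQ-symmetric {y} y∈Q x∈ with ∈-applyUpTo⁻ _ x∈
  ... | j , j<k , refl = subst (_∈ partnersP x) back (∈-applyUpTo⁺ _ j<k)
    where
      x : A
      x = at y P (position y Q ⊖ j)

      back : at x Q (position x P ⊕ j) ≡ y
      back = begin
        at x Q (position x P ⊕ j)       ≡⟨ cong (λ t → at x Q (t ⊕ j)) (position-at y P P-unique (<N⇒<|P| (⊖-< _ j))) ⟩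
        at x Q (position y Q ⊖ j ⊕ j)   ≡⟨ cong (at x Q) (⊖-⊕ (position-<N |Q|≡N y∈Q) (<⇒≤ (<k⇒<N j<k))) ⟩
        at x Q (position y Q)           ≡⟨ at-position x y∈Q ⟩
        y                               ∎
        where open ≡-Reasoning

module _ {A : Set} where

  ∈-take : ∀ n {x} {xs : List A} → x ∈ take n xs → x ∈ xs
  ∈-take n {xs = xs} p = subst (_ ∈_) (take++drop≡id n xs) (∈-++⁺ˡ p)

  ∈-drop : ∀ n {x} {xs : List A} → x ∈ drop n xs → x ∈ xs
  ∈-drop n {xs = xs} p = subst (_ ∈_) (take++drop≡id n xs) (∈-++⁺ʳ (take n xs) p)

  unique-++-disjoint : ∀ (xs : List A) {ys x} → Unique (xs ++ ys) → x ∈ xs → x ∈ ys → ⊥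
  unique-++-disjoint (z ∷ zs) u (here refl) x∈ys = Unique[x∷xs]⇒x∉xs u (∈-++⁺ʳ zs x∈ys)
  unique-++-disjoint (z ∷ zs) (_ ∷ u) (there x∈zs) x∈ys = unique-++-disjoint zs u x∈zs x∈ys

  sum-map-const : ∀ (f : A → ℕ) {c} xs → (∀ {x} → x ∈ xs → f x ≡ c) → sum (map f xs) ≡ length xs * c
  sum-map-const f []       _     = refl
  sum-map-const f (x ∷ xs) const = cong₂ _+_ (const (here refl)) (sum-map-const f xs (λ x∈ → const (there x∈)))

module PartVertices where

  Vertex : ∀ {m} → (Fin m → ℕ) → Set
  Vertex {m} ns = V (completeMultipartite m ns)

  firstPart : ∀ {m} (ns : Fin (suc m) → ℕ) → Bool → List (Vertex ns)
  firstPart ns true  = map (zero ,_) (allFin (ns zero))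
  firstPart ns false = []

  shift : ∀ {m} (ns : Fin (suc m) → ℕ) → Vertex (λ i → ns (suc i)) → Vertex ns
  shift ns (i , a) = (suc i , a)

  partVertices : ∀ {m} (ns : Fin m → ℕ) → Subset m → List (Vertex ns)
  partVertices {zero}  ns []      = []
  partVertices {suc m} ns (b ∷ J) = firstPart ns b ++ map (shift ns) (partVertices (λ i → ns (suc i)) J)

  length-firstPart : ∀ {m} (ns : Fin (suc m) → ℕ) b → length (firstPart ns b) ≡ (if b then ns zero else 0)
  length-firstPart ns true  = trans (length-map _ (allFin (ns zero))) (length-tabulate (λ i → i))
  length-firstPart ns false = refl

  length-partVertices : ∀ {m} (ns : Fin m → ℕ) J → length (partVertices ns J) ≡ sumOver ns J
  length-partVertices {zero}  ns []      = refl
  length-partVertices {suc m} ns (b ∷ J) =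
    trans (length-++ (firstPart ns b))
          (cong₂ _+_ (length-firstPart ns b)
                     (trans (length-map (shift ns) (partVertices _ J)) (length-partVertices _ J)))

  ∈-firstPart : ∀ {m} (ns : Fin (suc m) → ℕ) b {x} → x ∈ firstPart ns b → proj₁ x ≡ zero × b ≡ true
  ∈-firstPart ns true x∈ with ∈-map⁻ (zero ,_) x∈
  ... | _ , _ , refl = refl , refl

  partVertices-∈⁻ : ∀ {m} (ns : Fin m → ℕ) J {i a} → (i , a) ∈ partVertices ns J → lookup J i ≡ true
  partVertices-∈⁻ {suc m} ns (b ∷ J) x∈ with ∈-++⁻ (firstPart ns b) x∈
  ... | inj₁ p with ∈-firstPart ns b p
  ...   | refl , refl = refl
  partVertices-∈⁻ {suc m} ns (b ∷ J) x∈ | inj₂ p with ∈-map⁻ (shift ns) p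
  ...   | _ , q , refl = partVertices-∈⁻ _ J q

  partVertices-∈⁺ : ∀ {m} (ns : Fin m → ℕ) J {i} (a : Fin (ns i)) → lookup J i ≡ true →
                    (i , a) ∈ partVertices ns J
  partVertices-∈⁺ {suc m} ns (true ∷ J) {zero}  a _ = ∈-++⁺ˡ (∈-map⁺ (zero ,_) (∈-allFin a))
  partVertices-∈⁺ {suc m} ns (b ∷ J)    {suc i} a i∈J =
    ∈-++⁺ʳ (firstPart ns b) (∈-map⁺ (shift ns) (partVertices-∈⁺ _ J a i∈J))

  partVertices-unique : ∀ {m} (ns : Fin m → ℕ) J → Unique (partVertices ns J)
  partVertices-unique {zero}  ns []      = []
  partVertices-unique {suc m} ns (b ∷ J) =
    ++⁺ (firstPart-unique b) (map⁺ shift-injective (partVertices-unique _ J)) disjoint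
    where
      firstPart-unique : ∀ b → Unique (firstPart ns b)
      firstPart-unique true  = map⁺ (λ { refl → refl }) (allFin⁺ _)
      firstPart-unique false = []

      shift-injective : ∀ {x y} → shift ns x ≡ shift ns y → x ≡ y
      shift-injective refl = refl

      disjoint : ∀ {v} → v ∈ firstPart ns b × v ∈ map (shift ns) (partVertices _ J) → ⊥
      disjoint (p , q) with ∈-firstPart ns b p | ∈-map⁻ (shift ns) q
      ... | () , _ | _ , _ , refl

  sumOver-∁ : ∀ {m} (ns : Fin m → ℕ) J → sumOver ns J + sumOver ns (∁ J) ≡ total ns
  sumOver-∁ {zero}  ns []          = refl
  sumOver-∁ {suc m} ns (true ∷ J)  = trans (+-assoc (ns zero) _ _) (cong (ns zero +_) (sumOver-∁ _ J))
  sumOver-∁ {suc m} ns (false ∷ J) = begin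
    s + (n₀ + s̄)   ≡⟨ sym (+-assoc s n₀ s̄) ⟩
    s + n₀ + s̄     ≡⟨ cong (_+ s̄) (+-comm s n₀) ⟩
    n₀ + s + s̄     ≡⟨ +-assoc n₀ s s̄ ⟩
    n₀ + (s + s̄)   ≡⟨ cong (n₀ +_) (sumOver-∁ _ J) ⟩
    n₀ + total (λ i → ns (suc i)) ∎
    where
      open ≡-Reasoning
      n₀ s s̄ : ℕ
      n₀ = ns zero
      s  = sumOver (λ i → ns (suc i)) J
      s̄  = sumOver (λ i → ns (suc i)) (∁ J)

-- Vertices of A and B₁ choose
-- their k partners in the circulant pairing of A and B₁, vertices of B₂ choose
-- k+1 vertices of A.  Every choice crosses between A and B, hence is an edge.
module HalfSplit {m : ℕ} (ns : Fin m → ℕ) (J : Subset m) {k : ℕ}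
  (k<N : k < sumOver ns J) (2N≤n : 2 * sumOver ns J ≤ total ns) where

  open PartVertices

  G : Graph
  G = completeMultipartite m ns

  open import Data.List.Membership.DecPropositional (_≟V_ G) using (_∈?_)

  N : ℕ
  N = sumOver ns J

  A B B₁ B₂ : List (Vertex ns)
  A  = partVertices ns J
  B  = partVertices ns (∁ J)
  B₁ = take N B
  B₂ = drop N B

  |A|≡N : length A ≡ N
  |A|≡N = length-partVertices ns J

  N≤|B| : N ≤ length B
  N≤|B| = +-cancelˡ-≤ N N (length B) (begin
    N + N                  ≡⟨ cong (N +_) (+-identityʳ N) ⟨
    2 * N                  ≤⟨ 2N≤n ⟩
    total ns               ≡⟨ sumOver-∁ ns J ⟨
    N + sumOver ns (∁ J)   ≡⟨ cong (N +_) (length-partVertices ns (∁ J)) ⟨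
    N + length B           ∎)
    where open ≤-Reasoning

  |B₁|≡N : length B₁ ≡ N
  |B₁|≡N = trans (length-take N B) (m≤n⇒m⊓n≡m N≤|B|)

  B-unique : Unique B
  B-unique = partVertices-unique ns (∁ J)

  B₁++B₂-unique : Unique (B₁ ++ B₂)
  B₁++B₂-unique = subst Unique (sym (take++drop≡id N B)) B-unique

  true≢false : true ≢ false
  true≢false ()

  ∈A⇒∈J : ∀ {x} → x ∈ A → lookup J (proj₁ x) ≡ true
  ∈A⇒∈J x∈ = partVertices-∈⁻ ns J x∈

  ∈B⇒∉J : ∀ {x} → x ∈ B → lookup J (proj₁ x) ≡ false
  ∈B⇒∉J {i , _} x∈ with lookup J i | trans (sym (lookup-map i not J)) (partVertices-∈⁻ ns (∁ J) x∈)
  ... | false | _ = refl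

  A-B-disjoint : ∀ {x} → x ∈ A → x ∈ B → ⊥
  A-B-disjoint x∈A x∈B = true≢false (trans (sym (∈A⇒∈J x∈A)) (∈B⇒∉J x∈B))

  B₁-B₂-disjoint : ∀ {x} → x ∈ B₁ → x ∈ B₂ → ⊥
  B₁-B₂-disjoint = unique-++-disjoint B₁ B₁++B₂-unique

  adjacent-if-sides-differ : ∀ {x y} → lookup J (proj₁ x) ≢ lookup J (proj₁ y) → T (adj G x y)
  adjacent-if-sides-differ {i , _} {j , _} differ
    rewrite ⌊⌋-no (i Fin.≟ j) (λ i≡j → differ (cong (lookup J) i≡j)) = _

  A-B-adjacent : ∀ {x y} → x ∈ A → y ∈ B → T (adj G x y)
  A-B-adjacent {x} {y} x∈ y∈ = adjacent-if-sides-differ {x} {y} λ eq →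
    true≢false (trans (sym (∈A⇒∈J x∈)) (trans eq (∈B⇒∉J y∈)))

  B-A-adjacent : ∀ {x y} → x ∈ B → y ∈ A → T (adj G x y)
  B-A-adjacent {x} {y} x∈ y∈ = adjacent-if-sides-differ {x} {y} λ eq →
    true≢false (trans (sym (∈A⇒∈J y∈)) (trans (sym eq) (∈B⇒∉J x∈)))

  loopless : Loopless G
  loopless {i , _} t refl rewrite ⌊⌋-yes (i Fin.≟ i) refl = t

  ∉A⇒∈B : ∀ {x} → x ∉ A → x ∈ B
  ∉A⇒∈B {i , a} x∉A with lookup J i in eq
  ... | true  = ⊥-elim (x∉A (partVertices-∈⁺ ns J a eq))
  ... | false = partVertices-∈⁺ ns (∁ J) a (trans (lookup-map i not J) (cong not eq))

  data Block (x : Vertex ns) : Set where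
    inA  : x ∈ A  → Block x
    inB₁ : x ∈ B₁ → Block x
    inB₂ : x ∈ B₂ → Block x

  block : ∀ x → Block x
  block x with x ∈? A
  ... | yes x∈A = inA x∈A
  ... | no  x∉A with ∈-++⁻ B₁ (subst (x ∈_) (sym (take++drop≡id N B)) (∉A⇒∈B x∉A))
  ...   | inj₁ x∈B₁ = inB₁ x∈B₁
  ...   | inj₂ x∈B₂ = inB₂ x∈B₂

  open Circulant (_≟V_ G) k<N (partVertices-unique ns J) (take⁺ N B-unique) |A|≡N |B₁|≡N

  chooseIn : ∀ {x} → Block x → List (Vertex ns)
  chooseIn {x} (inA _)  = partnersP x
  chooseIn {x} (inB₁ _) = partnersQ x
  chooseIn     (inB₂ _) = take (suc k) A

  chosen : Vertex ns → List (Vertex ns)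
  chosen x = chooseIn (block x)

  chosen-A : ∀ {x} → x ∈ A → chosen x ≡ partnersP x
  chosen-A {x} x∈A with block x
  ... | inA _     = refl
  ... | inB₁ x∈B₁ = ⊥-elim (A-B-disjoint x∈A (∈-take N x∈B₁))
  ... | inB₂ x∈B₂ = ⊥-elim (A-B-disjoint x∈A (∈-drop N x∈B₂))

  chosen-B₁ : ∀ {x} → x ∈ B₁ → chosen x ≡ partnersQ x
  chosen-B₁ {x} x∈B₁ with block x
  ... | inA x∈A   = ⊥-elim (A-B-disjoint x∈A (∈-take N x∈B₁))
  ... | inB₁ _    = refl
  ... | inB₂ x∈B₂ = ⊥-elim (B₁-B₂-disjoint x∈B₁ x∈B₂)

  chosen-B₂ : ∀ {x} → x ∈ B₂ → chosen x ≡ take (suc k) A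
  chosen-B₂ {x} x∈B₂ with block x
  ... | inA x∈A   = ⊥-elim (A-B-disjoint x∈A (∈-drop N x∈B₂))
  ... | inB₁ x∈B₁ = ⊥-elim (B₁-B₂-disjoint x∈B₁ x∈B₂)
  ... | inB₂ _    = refl

  length-take-A : length (take (suc k) A) ≡ suc k
  length-take-A = trans (length-take (suc k) A) (m≤n⇒m⊓n≡m (subst (suc k ≤_) (sym |A|≡N) k<N))

  block-∈-vertices : ∀ {x} → Block x → x ∈ A ++ B₁ ++ B₂
  block-∈-vertices (inA x∈A)   = ∈-++⁺ˡ x∈A
  block-∈-vertices (inB₁ x∈B₁) = ∈-++⁺ʳ A (∈-++⁺ˡ x∈B₁)
  block-∈-vertices (inB₂ x∈B₂) = ∈-++⁺ʳ A (∈-++⁺ʳ B₁ x∈B₂)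

  chooseIn-unique : ∀ {x} (b : Block x) → Unique (chooseIn b)
  chooseIn-unique (inA x∈A)   = partnersP-unique x∈A
  chooseIn-unique (inB₁ x∈B₁) = partnersQ-unique x∈B₁
  chooseIn-unique (inB₂ _)    = take⁺ (suc k) (partVertices-unique ns J)

  chooseIn-adjacent : ∀ {x y} (b : Block x) → y ∈ chooseIn b → T (adj G x y)
  chooseIn-adjacent (inA x∈A)   y∈ = A-B-adjacent x∈A (∈-take N (partnersP-⊆ y∈))
  chooseIn-adjacent (inB₁ x∈B₁) y∈ = B-A-adjacent (∈-take N x∈B₁) (partnersQ-⊆ y∈)
  chooseIn-adjacent (inB₂ x∈B₂) y∈ = B-A-adjacent (∈-drop N x∈B₂) (∈-take (suc k) y∈)

  chooseIn-enough : ∀ {x} (b : Block x) → suc k ≤ length (chooseIn b)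
                    ⊎ (k ≤ length (chooseIn b) × (∀ {y} → y ∈ chooseIn b → x ∈ chosen y))
  chooseIn-enough {x} (inA x∈A) = inj₂ (≤-reflexive (sym (length-partnersP x)) , λ y∈ →
    subst (x ∈_) (sym (chosen-B₁ (partnersP-⊆ y∈))) (partnersP-symmetric x∈A y∈))
  chooseIn-enough {x} (inB₁ x∈B₁) = inj₂ (≤-reflexive (sym (length-partnersQ x)) , λ y∈ →
    subst (x ∈_) (sym (chosen-A (partnersQ-⊆ y∈))) (partnersQ-symmetric x∈B₁ y∈))
  chooseIn-enough (inB₂ _) = inj₁ (≤-reflexive (sym length-take-A))

  selection : Selection G k
  selection = record
    { vertices          = A ++ B₁ ++ B₂
    ; vertices-unique   = ++⁺ (partVertices-unique ns J) B₁++B₂-unique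
                              (λ (x∈A , x∈B) → A-B-disjoint x∈A (subst (_ ∈_) (take++drop≡id N B) x∈B))
    ; vertices-complete = λ x → block-∈-vertices (block x)
    ; chosen            = chosen
    ; chosen-unique     = λ x → chooseIn-unique (block x)
    ; chosen-adjacent   = λ {x} → chooseIn-adjacent (block x)
    ; chosen-enough     = λ x → chooseIn-enough (block x)
    }

  size-selection : Selection.size selection ≡ N * k + (N * k + length B₂ * suc k)
  size-selection = begin
    sum (map ℓ (A ++ B₁ ++ B₂))                             ≡⟨ sum-map-++ A ⟩
    sum (map ℓ A) + sum (map ℓ (B₁ ++ B₂))                  ≡⟨ cong (sum (map ℓ A) +_) (sum-map-++ B₁) ⟩
    sum (map ℓ A) + (sum (map ℓ B₁) + sum (map ℓ B₂))       ≡⟨ cong₂ _+_ countA (cong₂ _+_ countB₁ countB₂) ⟩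
    N * k + (N * k + length B₂ * suc k)                     ∎
    where
      open ≡-Reasoning
      ℓ : Vertex ns → ℕ
      ℓ x = length (chosen x)

      sum-map-++ : ∀ xs {ys} → sum (map ℓ (xs ++ ys)) ≡ sum (map ℓ xs) + sum (map ℓ ys)
      sum-map-++ xs {ys} = trans (cong sum (map-++ ℓ xs ys)) (sum-++ (map ℓ xs) (map ℓ ys))

      countA : sum (map ℓ A) ≡ N * k
      countA = trans (sum-map-const ℓ A (λ x∈ → trans (cong length (chosen-A x∈)) (length-partnersP _)))
                     (cong (_* k) |A|≡N)

      countB₁ : sum (map ℓ B₁) ≡ N * k
      countB₁ = trans (sum-map-const ℓ B₁ (λ x∈ → trans (cong length (chosen-B₁ x∈)) (length-partnersQ _)))
                      (cong (_* k) |B₁|≡N)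

      countB₂ : sum (map ℓ B₂) ≡ length B₂ * suc k
      countB₂ = sum-map-const ℓ B₂ (λ x∈ → trans (cong length (chosen-B₂ x∈)) length-take-A)

  -- With |B| = N + r this is 2Nk + r(k+1) = n(k+1) - 2N.
  size-selection-≡ : Selection.size selection ≡ total ns * (k + 1) ∸ 2 * N
  size-selection-≡ = begin
    size                              ≡⟨ m+n∸n≡m size (2 * N) ⟨
    size + 2 * N ∸ 2 * N              ≡⟨ cong (λ t → t + 2 * N ∸ 2 * N) size-selection ⟩
    N * k + (N * k + r * suc k) + 2 * N ∸ 2 * N   ≡⟨ cong (_∸ 2 * N) (count N r k) ⟩
    (N + (N + r)) * (k + 1) ∸ 2 * N   ≡⟨ cong (λ t → t * (k + 1) ∸ 2 * N) n≡N+N+r ⟨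
    total ns * (k + 1) ∸ 2 * N        ∎
    where
      open ≡-Reasoning
      size r : ℕ
      size = Selection.size selection
      r    = length B₂

      count : ∀ N r k → N * k + (N * k + r * suc k) + 2 * N ≡ (N + (N + r)) * (k + 1)
      count = solve-∀

      n≡N+N+r : total ns ≡ N + (N + r)
      n≡N+N+r = begin
        total ns                     ≡⟨ sumOver-∁ ns J ⟨
        N + sumOver ns (∁ J)         ≡⟨ cong (N +_) (length-partVertices ns (∁ J)) ⟨
        N + length B                 ≡⟨ cong (N +_) (m+[n∸m]≡n N≤|B|) ⟨
        N + (N + (length B ∸ N))     ≡⟨ cong (λ t → N + (N + t)) (length-drop N B) ⟨
        N + (N + r)                  ∎

half-split-dominates : ∀ {m} (ns : Fin m → ℕ) (J : Subset m) {k} →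
  k < sumOver ns J → 2 * sumOver ns J ≤ total ns →
  ∃[ S ] (IsKTupleTDS (inflate (completeMultipartite m ns)) k S
          × length S ≤ total ns * (k + 1) ∸ 2 * sumOver ns J)
half-split-dominates ns J k<N 2N≤n =
  let (S , S-tds , |S|≤size) = selection-dominates loopless selection
  in S , S-tds , ≤-trans |S|≤size (≤-reflexive size-selection-≡)
  where open HalfSplit ns J k<N 2N≤n

-- Proposition 4.6.  Take J with Σ_{i∈J} n_i = n' ≤ n/2 (it exists by the
-- definition of n') and apply `half-split-dominates`.
proposition4p6 : (m : ℕ) (ns : Fin m → ℕ) → (∀ i → 1 ≤ ns i) →
    (n' : ℕ) → IsMaxHalfSum ns n' →
    (k : ℕ) → 2 ≤ k → k < n' →
    ∃[ S ] (IsKTupleTDS (inflate (completeMultipartite m ns)) k S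
            × length S ≤ total ns * (k + 1) ∸ 2 * n')
proposition4p6 m ns _ _ ((J , 2n'≤n , refl) , _) k _ k<n' = half-split-dominates ns J k<n' 2n'≤n
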